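{- No finite tree is irreducibly odd. Equivalently, every finite irreducibly odd graph contains a cycle.
   Context: All graphs are finite and simple. A graph is \emph{odd} if every vertex has odd degree. A graph $G$ is \emph{irreducibly odd} if it is odd and for every pair of distinct vertices $u,v$ of $G$ there exists a third vertex $w \notin \{u,v\}$ that is adjacent to exactly one of $u$ and $v$. -}

module Defs where

open import Data.Bool using (Bool; true; false; if_then_else_)
open import Data.Nat using (ℕ; zero; suc; _≤_; _%_)
open import Data.Fin using (Fin)
open import Data.List using (List; []; _∷_; _∷ʳ_; length; map; allFin)
open import Data.Nat.ListAction using (sum)
open import Data.List.Relation.Unary.Linked using (Linked)
open import Data.List.Relation.Unary.Unique.Propositional using (Unique)
open import Data.Product using (Σ; _×_; ∃; ∃-syntax)
open import Relation.Binary.PropositionalEquality using (_≡_; _≢_)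
open import Relation.Nullary using (¬_)

record Graph (n : ℕ) : Set where
  field
    adj    : Fin n → Fin n → Bool
    sym    : ∀ u v → adj u v ≡ adj v u
    irrefl : ∀ v → adj v v ≡ false

open Graph public

module _ {n : ℕ} (G : Graph n) where

  Adj : Fin n → Fin n → Set
  Adj u v = adj G u v ≡ true

  degree : Fin n → ℕ
  degree v = sum (map (λ w → if adj G v w then 1 else 0) (allFin n))

  IsOdd : Set
  IsOdd = ∀ v → degree v % 2 ≡ 1

  IrreduciblyOdd : Set
  IrreduciblyOdd =
    IsOdd ×
    (∀ u v → u ≢ v →
      ∃[ w ] (w ≢ u × w ≢ v × adj G w u ≢ adj G w v))

  data Walk : Fin n → Fin n → Set where
    here : ∀ {u} → Walk u u
    step : ∀ {u v w} → Adj u v → Walk v w → Walk u w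

  Connected : Set
  Connected = ∀ u v → Walk u v

  Cycle : Set
  Cycle = Σ (Fin n) λ v → Σ (List (Fin n)) λ xs →
    (2 ≤ length xs) × Unique (v ∷ xs) × Linked Adj ((v ∷ xs) ∷ʳ v)

  Acyclic : Set
  Acyclic = ¬ Cycle

  IsTree : Set
  IsTree = (1 ≤ n) × Connected × Acyclic

module Submission where

-- Call a vertex a leaf if it has degree 1.  Irreducibility forbids "twins"
-- (two vertices with the same neighbours outside themselves), so two leaves
-- are never adjacent and no vertex has two distinct leaf neighbours.  Hence a
-- non-leaf x, whose odd degree is at least 3, has a non-leaf neighbour
-- outside any prescribed vertex y; and non-leaves exist, because a leaf's
-- neighbour is not a leaf.  Finally, a nonempty vertex set in which every
-- member has two neighbours inside the set contains a cycle: extend a simple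
-- path inside the set until the new vertex is already on the path, which
-- must happen because a simple path has at most n vertices.

open import Defs
open import Data.Nat using (ℕ)
open import Relation.Nullary using (¬_)

open import Algebra.Properties.CommutativeSemigroup using (x∙yz≈y∙xz)
open import Data.Bool using (Bool; true; false; if_then_else_) renaming (_≟_ to _≟ᵇ_)
open import Data.Empty using (⊥; ⊥-elim)
open import Data.Fin using (Fin; zero; suc; _≟_)
open import Data.Fin.Properties using (any?)
open import Data.List using (List; []; _∷_; _∷ʳ_; length; tabulate)
open import Data.List.Membership.Propositional using (_∈_; _∉_)
open import Data.List.Properties using (map-tabulate)
open import Data.List.Relation.Unary.All as All using (All; []; _∷_)
open import Data.List.Relation.Unary.All.Properties using (¬Any⇒All¬)
open import Data.List.Relation.Unary.Any using (here; there)
open import Data.List.Relation.Unary.Linked using (Linked; []; [-]; _∷_)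
open import Data.List.Relation.Unary.Unique.Propositional using (Unique; []; _∷_)
open import Data.Nat using (suc; _+_; _≤_; _<_; _%_; z≤n; s≤s) renaming (_≟_ to _≟ℕ_)
open import Data.Nat.ListAction using (sum)
open import Data.Nat.Properties
  using (+-commutativeSemigroup; +-mono-≤; +-suc; ≤-reflexive; m<m+n; <⇒≱; 1+n≰n; module ≤-Reasoning)
open import Data.Product using (∃; ∃-syntax; _×_; _,_; proj₁; proj₂)
open import Function using (_∘_; case_of_)
open import Relation.Binary.PropositionalEquality
  using (_≡_; _≢_; refl; trans; cong; subst; ≢-sym; module ≡-Reasoning)
  renaming (sym to ≡-sym)
open import Relation.Nullary using (Dec; yes; no; does; ¬?)
open import Relation.Nullary.Decidable using (_×-dec_; decidable-stable)

indicator : Bool → ℕ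
indicator b = if b then 1 else 0

count : ∀ {n} → (Fin n → Bool) → ℕ
count {0}     p = 0
count {suc n} p = indicator (p zero) + count (p ∘ suc)

remove : ∀ {n} → Fin n → (Fin n → Bool) → Fin n → Bool
remove a p w = if does (w ≟ a) then false else p w

remove-elsewhere : ∀ {n} {a w : Fin n} (p : Fin n → Bool) → w ≢ a → remove a p w ≡ p w
remove-elsewhere {a = a} {w} p w≢a with w ≟ a
... | yes w≡a = ⊥-elim (w≢a w≡a)
... | no _    = refl

remove-support : ∀ {n} {a w : Fin n} (p : Fin n → Bool) → remove a p w ≡ true → w ≢ a × p w ≡ true
remove-support {a = a} {w} p pw with w ≟ a
remove-support p () | yes _
... | no w≢a = w≢a , pw

count-remove : ∀ {n} (a : Fin n) (p : Fin n → Bool) → count p ≡ indicator (p a) + count (remove a p)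
count-remove zero    p = refl
count-remove (suc a) p = begin
  indicator (p zero) + count (p ∘ suc)
    ≡⟨ cong (indicator (p zero) +_) (count-remove a (p ∘ suc)) ⟩
  indicator (p zero) + (indicator (p (suc a)) + count (remove a (p ∘ suc)))
    ≡⟨ x∙yz≈y∙xz +-commutativeSemigroup (indicator (p zero)) (indicator (p (suc a))) _ ⟩
  indicator (p (suc a)) + (indicator (p zero) + count (remove a (p ∘ suc)))  ∎
  where open ≡-Reasoning

count-empty : ∀ {n} (p : Fin n → Bool) → (∀ w → p w ≢ true) → count p ≡ 0
count-empty {0}     p none = refl
count-empty {suc n} p none with p zero in p₀
... | true  = ⊥-elim (none zero p₀)
... | false = count-empty (p ∘ suc) (none ∘ suc)

indicator≤1 : ∀ b → indicator b ≤ 1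
indicator≤1 true  = s≤s z≤n
indicator≤1 false = z≤n

count≤length : ∀ {n} (p : Fin n → Bool) (xs : List (Fin n)) →
               (∀ w → p w ≡ true → w ∈ xs) → count p ≤ length xs
count≤length p []       covered = ≤-reflexive (count-empty p (λ w pw → case covered w pw of λ ()))
count≤length p (a ∷ xs) covered = begin
  count p                               ≡⟨ count-remove a p ⟩
  indicator (p a) + count (remove a p)  ≤⟨ +-mono-≤ (indicator≤1 (p a)) (count≤length (remove a p) xs covered′) ⟩
  suc (length xs)                       ∎
  where
  open ≤-Reasoning
  covered′ : ∀ w → remove a p w ≡ true → w ∈ xs
  covered′ w rw with remove-support p rw
  ... | w≢a , pw with covered w pw
  ...   | here w≡a  = ⊥-elim (w≢a w≡a)
  ...   | there w∈xs = w∈xs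

length≤count : ∀ {n} (p : Fin n → Bool) (xs : List (Fin n)) →
               Unique xs → All (λ w → p w ≡ true) xs → length xs ≤ count p
length≤count p []       []                 []         = z≤n
length≤count p (a ∷ xs) (a∉xs ∷ unique) (pa ∷ pxs) = begin
  suc (length xs)                       ≤⟨ s≤s (length≤count (remove a p) xs unique pxs′) ⟩
  indicator true + count (remove a p)   ≡⟨ cong (λ b → indicator b + count (remove a p)) (≡-sym pa) ⟩
  indicator (p a) + count (remove a p)  ≡⟨ ≡-sym (count-remove a p) ⟩
  count p                               ∎
  where
  open ≤-Reasoning
  pxs′ : All (λ w → remove a p w ≡ true) xs
  pxs′ = All.zipWith (λ (a≢w , pw) → trans (remove-elsewhere p (≢-sym a≢w)) pw) (a∉xs , pxs)

count-true : ∀ n → count (λ (_ : Fin n) → true) ≡ n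
count-true 0       = refl
count-true (suc n) = cong suc (count-true n)

unique-length≤ : ∀ {n} {xs : List (Fin n)} → Unique xs → length xs ≤ n
unique-length≤ {n} {xs} unique =
  subst (length xs ≤_) (count-true n) (length≤count (λ _ → true) xs unique (All.universal (λ _ → refl) xs))

sum-indicators : ∀ {n} (p : Fin n → Bool) → sum (tabulate (λ w → indicator (p w))) ≡ count p
sum-indicators {0}     p = refl
sum-indicators {suc n} p = cong (indicator (p zero) +_) (sum-indicators (p ∘ suc))

-- Initial segments of a list up to an occurrence of an element, used to cut a
-- cycle out of a path that runs into itself.

prefixTo : ∀ {A : Set} {z : A} {ys : List A} → z ∈ ys → List A
prefixTo {ys = y ∷ _} (here _)  = y ∷ []
prefixTo {ys = y ∷ _} (there p) = y ∷ prefixTo p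

prefixTo-nonempty : ∀ {A : Set} {z : A} {ys} (p : z ∈ ys) → 1 ≤ length (prefixTo p)
prefixTo-nonempty (here _)  = s≤s z≤n
prefixTo-nonempty (there _) = s≤s z≤n

prefixTo-All : ∀ {A : Set} {P : A → Set} {z : A} {ys} (p : z ∈ ys) → All P ys → All P (prefixTo p)
prefixTo-All (here _)  (px ∷ _)   = px ∷ []
prefixTo-All (there p) (px ∷ pxs) = px ∷ prefixTo-All p pxs

prefixTo-Unique : ∀ {A : Set} {z : A} {ys} (p : z ∈ ys) → Unique ys → Unique (prefixTo p)
prefixTo-Unique (here _)  (_ ∷ _)          = [] ∷ []
prefixTo-Unique (there p) (y∉ys ∷ unique) = prefixTo-All p y∉ys ∷ prefixTo-Unique p unique

prefixTo-Linked : ∀ {A : Set} {R : A → A → Set} {z x a : A} {ys} (p : z ∈ ys) →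
                  Linked R (a ∷ ys) → R z x → Linked R (a ∷ (prefixTo p ∷ʳ x))
prefixTo-Linked (here refl) (r ∷ _) rzx = r ∷ rzx ∷ [-]
prefixTo-Linked {ys = _ ∷ _ ∷ _} (there p) (r ∷ path) rzx = r ∷ prefixTo-Linked p path rzx

module _ {n : ℕ} (G : Graph n) where

  open import Data.List.Membership.DecPropositional (_≟_ {n}) using (_∈?_)

  adj-sym : ∀ {u v} → Adj G u v → Adj G v u
  adj-sym {u} {v} uv = trans (Graph.sym G v u) uv

  adj-distinct : ∀ {u v} → Adj G u v → u ≢ v
  adj-distinct {u} uv refl with trans (≡-sym uv) (Graph.irrefl G u)
  ... | ()

  Adj? : ∀ u v → Dec (Adj G u v)
  Adj? u v = adj G u v ≟ᵇ true

  degree≡count : ∀ v → degree G v ≡ count (adj G v)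
  degree≡count v =
    trans (cong sum (map-tabulate (λ w → w) (λ w → indicator (adj G v w)))) (sum-indicators (adj G v))

  neighbour-outside : ∀ v (xs : List (Fin n)) → length xs < degree G v → ∃[ w ] Adj G v w × w ∉ xs
  neighbour-outside v xs more with any? (λ w → Adj? v w ×-dec ¬? (w ∈? xs))
  ... | yes found = found
  ... | no none   = ⊥-elim (<⇒≱ more (subst (_≤ length xs) (≡-sym (degree≡count v)) (count≤length (adj G v) xs covered)))
    where
    covered : ∀ w → Adj G v w → w ∈ xs
    covered w vw = decidable-stable (w ∈? xs) (λ w∉xs → none (w , vw , w∉xs))

  neighbours≤degree : ∀ v (xs : List (Fin n)) → Unique xs → All (Adj G v) xs → length xs ≤ degree G v
  neighbours≤degree v xs unique vxs =
    subst (length xs ≤_) (≡-sym (degree≡count v)) (length≤count (adj G v) xs unique vxs)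

  close-cycle : ∀ {x y z} {zs} → Unique (x ∷ y ∷ zs) → Linked (Adj G) (x ∷ y ∷ zs) →
                z ∈ zs → Adj G z x → Cycle G
  close-cycle {x} {y} (x∉ ∷ unique) path z∈zs zx =
    x , y ∷ prefixTo z∈zs , s≤s (prefixTo-nonempty z∈zs) ,
    prefixTo-All (there z∈zs) x∉ ∷ prefixTo-Unique (there z∈zs) unique ,
    prefixTo-Linked (there z∈zs) path zx

  -- S is a vertex set in which every member has at least two neighbours in S:
  -- whichever vertex y is excluded, some neighbour in S remains.
  TwoNeighboursIn : (Fin n → Set) → Set
  TwoNeighboursIn S = ∀ x → S x → ∀ y → ∃[ z ] S z × Adj G x z × z ≢ y

  module _ (S : Fin n → Set) (rich : TwoNeighboursIn S) where

    -- Extend the simple path x ∷ y ∷ zs (x its current end, x ∈ S) by a new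
    -- S-neighbour of x until it runs into itself; the fuel can not run out
    -- since a simple path has at most n vertices.
    extend-path : (fuel : ℕ) → ∀ x y zs → n < fuel + length (x ∷ y ∷ zs) → S x →
                  Unique (x ∷ y ∷ zs) → Linked (Adj G) (x ∷ y ∷ zs) → Cycle G
    extend-path 0 x y zs long _ unique _ = ⊥-elim (<⇒≱ long (unique-length≤ unique))
    extend-path (suc fuel) x y zs long Sx unique path with rich x Sx y
    ... | z , Sz , xz , z≢y with z ∈? (x ∷ y ∷ zs)
    ...   | yes (here z≡x)             = ⊥-elim (adj-distinct xz (≡-sym z≡x))
    ...   | yes (there (here z≡y))     = ⊥-elim (z≢y z≡y)
    ...   | yes (there (there z∈zs))   = close-cycle unique path z∈zs (adj-sym xz)
    ...   | no z∉path = extend-path fuel z x (y ∷ zs) (subst (n <_) (≡-sym (+-suc fuel _)) long) Sz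
                          (¬Any⇒All¬ _ z∉path ∷ unique) (adj-sym xz ∷ path)

    cycle-in-rich-set : ∀ x → S x → Cycle G
    cycle-in-rich-set x Sx with rich x Sx x
    ... | y , Sy , xy , y≢x =
      extend-path n y x [] (m<m+n n (s≤s z≤n)) Sy
        ((y≢x ∷ []) ∷ [] ∷ []) (adj-sym xy ∷ [-])

  Separating : Set
  Separating = ∀ u v → u ≢ v → ∃[ w ] (w ≢ u × w ≢ v × adj G w u ≢ adj G w v)

  Leaf : Fin n → Set
  Leaf v = degree G v ≡ 1

  leaf-neighbour-unique : ∀ {u a b} → Leaf u → Adj G u a → Adj G u b → a ≡ b
  leaf-neighbour-unique {u} {a} {b} leaf ua ub with a ≟ b
  ... | yes a≡b = a≡b
  ... | no a≢b  = ⊥-elim (1+n≰n (subst (2 ≤_) leaf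
                    (neighbours≤degree u (a ∷ b ∷ []) ((a≢b ∷ []) ∷ [] ∷ []) (ua ∷ ub ∷ []))))

  bool-ext : ∀ {a b : Bool} → (a ≡ true → b ≡ true) → (b ≡ true → a ≡ true) → a ≡ b
  bool-ext {false} {false} _ _ = refl
  bool-ext {true}  {true}  _ _ = refl
  bool-ext {true}  {false} a⇒b _ = ≡-sym (a⇒b refl)
  bool-ext {false} {true}  _ b⇒a = b⇒a refl

  module _ (separating : Separating) where

    no-twins : ∀ {u v} → u ≢ v → (∀ w → w ≢ u → w ≢ v → Adj G w u → Adj G w v) →
               (∀ w → w ≢ u → w ≢ v → Adj G w v → Adj G w u) → ⊥
    no-twins {u} {v} u≢v u⇒v v⇒u with separating u v u≢v
    ... | w , w≢u , w≢v , differ = differ (bool-ext (u⇒v w w≢u w≢v) (v⇒u w w≢u w≢v))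

    -- Two adjacent leaves would be twins.
    adjacent-leaves : ∀ {u v} → Leaf u → Leaf v → Adj G u v → ⊥
    adjacent-leaves leaf-u leaf-v uv = no-twins (adj-distinct uv)
      (λ w _ w≢v wu → ⊥-elim (w≢v (leaf-neighbour-unique leaf-u (adj-sym wu) uv)))
      (λ w w≢u _ wv → ⊥-elim (w≢u (leaf-neighbour-unique leaf-v (adj-sym wv) (adj-sym uv))))

    -- Two leaves hanging from the same vertex would be twins.
    leaf-neighbours-coincide : ∀ {x u v} → Leaf u → Leaf v → Adj G x u → Adj G x v → u ≡ v
    leaf-neighbours-coincide {u = u} {v} leaf-u leaf-v xu xv with u ≟ v
    ... | yes u≡v = u≡v
    ... | no u≢v  = ⊥-elim (no-twins u≢v
      (λ w _ _ wu → subst (λ t → Adj G t v) (≡-sym (leaf-neighbour-unique leaf-u (adj-sym wu) (adj-sym xu))) xv)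
      (λ w _ _ wv → subst (λ t → Adj G t u) (≡-sym (leaf-neighbour-unique leaf-v (adj-sym wv) (adj-sym xv))) xu))

odd≢1⇒3≤ : ∀ d → d % 2 ≡ 1 → d ≢ 1 → 3 ≤ d
odd≢1⇒3≤ 0 () _
odd≢1⇒3≤ 1 _ d≢1 = ⊥-elim (d≢1 refl)
odd≢1⇒3≤ 2 () _
odd≢1⇒3≤ (suc (suc (suc d))) _ _ = s≤s (s≤s (s≤s z≤n))

module _ {n : ℕ} (G : Graph n) (irreducibly-odd : IrreduciblyOdd G) where

  NonLeaf : Fin n → Set
  NonLeaf v = ¬ Leaf G v

  separating : Separating G
  separating = proj₂ irreducibly-odd

  nonleaf-neighbour : ∀ x y ℓ → NonLeaf x → (∀ z → Adj G x z → Leaf G z → z ≡ ℓ) →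
                      ∃[ z ] NonLeaf z × Adj G x z × z ≢ y
  nonleaf-neighbour x y ℓ nonleaf only-ℓ
    with neighbour-outside G x (y ∷ ℓ ∷ []) (odd≢1⇒3≤ _ (proj₁ irreducibly-odd x) nonleaf)
  ... | z , xz , z∉ = z , (λ leaf → z∉ (there (here (only-ℓ z xz leaf)))) , xz , (λ z≡y → z∉ (here z≡y))

  -- Every non-leaf has two non-leaf neighbours: it has at most one leaf
  -- neighbour, found by search if it exists.
  nonleaves-rich : TwoNeighboursIn G NonLeaf
  nonleaves-rich x nonleaf y with any? (λ ℓ → Adj? G x ℓ ×-dec (degree G ℓ ≟ℕ 1))
  ... | yes (ℓ , xℓ , leaf-ℓ) =
    nonleaf-neighbour x y ℓ nonleaf (λ z xz leaf-z → leaf-neighbours-coincide G separating leaf-z leaf-ℓ xz xℓ)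
  ... | no no-leaf = nonleaf-neighbour x y y nonleaf (λ z xz leaf-z → ⊥-elim (no-leaf (z , xz , leaf-z)))

  -- Every vertex is a non-leaf or the neighbour of one.
  nonleaf-exists : Fin n → ∃ NonLeaf
  nonleaf-exists v with degree G v ≟ℕ 1
  ... | no nonleaf = v , nonleaf
  ... | yes leaf with neighbour-outside G v [] (≤-reflexive (≡-sym leaf))
  ...   | u , vu , _ = u , (λ leaf-u → adjacent-leaves G separating leaf leaf-u vu)

  irreducibly-odd⇒cycle : Fin n → Cycle G
  irreducibly-odd⇒cycle v with nonleaf-exists v
  ... | x , nonleaf = cycle-in-rich-set G NonLeaf nonleaves-rich x nonleaf

lemma3p1 : (n : ℕ) (G : Graph n) → IsTree G → ¬ IrreduciblyOdd G
lemma3p1 0       G (() , _)           _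
lemma3p1 (suc n) G (_ , _ , acyclic) irreducibly-odd = acyclic (irreducibly-odd⇒cycle G irreducibly-odd zero)
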